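{- Let $R$ be a finite commutative chain ring, $E$ a finite set, $C\le R^E$ an $R$-code, and $X\subseteq E$. If $C$ is contractible by $X$, then $M(C_X)=M(C)/X$.
   Context: $R$ has maximal ideal $\mathfrak{m}=\langle\theta\rangle$ with nilpotency index $\nu$. Vectors are modular independent if $\sum\alpha_iv_i=0$ implies all $\alpha_i\in\mathfrak{m}$. $M(C)$ is the independence system on $E$ whose independent sets are the $I\subseteq E$ for which the columns indexed by $I$ of a generator matrix of $C$ (rows forming a minimal generating set) are modular independent; circuits are minimal dependent sets. For $Y\subseteq E$, the shortened code is $C_Y=\{\mathbf{c}|_{E\setminus Y}:\mathbf{c}\in C,\ c_i=0\ \forall i\in Y\}$. For $e\in E$ with $\mathrm{pr}_e(C)=\{c_e:\mathbf{c}\in C\}\neq\{0\}$, write $\mathrm{pr}_e(C)=\langle\theta^t\rangle$, $0\le t<\nu$; $C$ is contractible by $e$ if some $\mathbf{c}\in C$ has $c_e=u\theta^t$ with $u$ a unit and $c_i\in\langle\theta^t\rangle$ for all $i\in E$. $C$ is contractible by $X$ if there is an ordering $X=\{x_1,\dots,x_\ell\}$ such that, with $C^{(0)}=C$ and $C^{(j)}=(C^{(j-1)})_{\{x_j\}}$, each $C^{(j-1)}$ is contractible by $x_j$ ($1\le j\le\ell$). For an independence system with circuit family $\mathcal{C}$ and an independent set $T$, the contraction $M/T$ is the independence system on $E\setminus T$ whose circuits are the inclusion-minimal members of $\{D\setminus T: D\in\mathcal{C}\}$. -}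

module Defs where

open import Level using (0ℓ)
open import Algebra.Bundles using (CommutativeRing)
open import Data.Nat using (ℕ; zero; suc)
open import Data.Fin using (Fin; zero; suc)
open import Data.Fin.Subset using (Subset; _∈_; _∉_; _⊆_; _⊂_; _─_; ∁)
open import Data.List using (List; []; _∷_)
open import Data.List.Relation.Unary.Any using (Any)
open import Data.List.Relation.Unary.Unique.Propositional using (Unique)
import Data.List.Membership.Propositional as LMem
open import Data.Product using (Σ; ∃; _×_; _,_)
open import Data.Sum using (_⊎_)
open import Data.Unit using () renaming (⊤ to Unit)
open import Relation.Nullary using (¬_)
open import Relation.Binary.PropositionalEquality using (_≡_)
open import Function.Bundles using (_⇔_)

module _ (R : CommutativeRing 0ℓ 0ℓ) where
  open CommutativeRing R using (Carrier; _≈_; _+_; _*_; 0#; 1#)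

  record IsIdeal (P : Carrier → Set) : Set where
    field
      resp  : ∀ {x y} → x ≈ y → P x → P y
      zero∈ : P 0#
      +-closed : ∀ {x y} → P x → P y → P (x + y)
      *-closed : ∀ r {x} → P x → P (r * x)

  record IsFiniteChainRing : Set₁ where
    field
      finite : Σ (List Carrier) λ xs → ∀ x → Any (x ≈_) xs
      chain  : ∀ (I J : Carrier → Set) → IsIdeal I → IsIdeal J →
               (∀ x → I x → J x) ⊎ (∀ x → J x → I x)

  ⟨_⟩ : Carrier → Carrier → Set
  ⟨ a ⟩ x = Σ Carrier λ r → x ≈ r * a

  IsUnit : Carrier → Set
  IsUnit u = Σ Carrier λ v → u * v ≈ 1#

  IsMaximalIdeal : (Carrier → Set) → Set₁
  IsMaximalIdeal P =
    IsIdeal P × ¬ P 1# ×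
    (∀ (J : Carrier → Set) → IsIdeal J → (∀ x → P x → J x) →
       (∀ x → J x → P x) ⊎ J 1#)

  pow : Carrier → ℕ → Carrier
  pow a zero    = 1#
  pow a (suc t) = a * pow a t

  -- Codes in R^E with E = Fin n.

  Vec : ℕ → Set
  Vec n = Fin n → Carrier

  sumF : ∀ {k} → (Fin k → Carrier) → Carrier
  sumF {zero}  f = 0#
  sumF {suc k} f = f zero + sumF (λ i → f (suc i))

  record IsCode {n} (C : Vec n → Set) : Set where
    field
      resp     : ∀ {u v} → (∀ i → u i ≈ v i) → C u → C v
      zero∈    : C (λ _ → 0#)
      +-closed : ∀ {u v} → C u → C v → C (λ i → u i + v i)
      *-closed : ∀ r {u} → C u → C (λ i → r * u i)

  Generates : ∀ {n k} → (Vec n → Set) → (Fin k → Vec n) → Set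
  Generates {n} {k} C G = ∀ v → C v ⇔
    (Σ (Fin k → Carrier) λ α → ∀ i → v i ≈ sumF (λ j → α j * G j i))

  -- ... minimally: no proper subset of the rows generates C
  -- (equivalently, for no row j do the rows other than j span C).
  MinimallyGenerates : ∀ {n k} → (Vec n → Set) → (Fin k → Vec n) → Set
  MinimallyGenerates {n} {k} C G =
    Generates C G ×
    (∀ (j : Fin k) → ¬ (∀ v → C v →
       Σ (Fin k → Carrier) λ α → α j ≈ 0# × (∀ i → v i ≈ sumF (λ l → α l * G l i))))

  ModIndepCols : ∀ {n k} → Carrier → (Fin k → Vec n) → Subset n → Set
  ModIndepCols {n} {k} θ G I =
    ∀ (α : Fin n → Carrier) → (∀ i → i ∉ I → α i ≈ 0#) →
    (∀ j → sumF (λ i → α i * G j i) ≈ 0#) →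
    ∀ i → i ∈ I → ⟨ θ ⟩ (α i)

  IsCircuit : ∀ {n} → (S : Subset n) → (Subset n → Set) → Subset n → Set
  IsCircuit S Ind D = D ⊆ S × ¬ Ind D × (∀ D′ → D′ ⊂ D → Ind D′)

  M : ∀ {n k} → Carrier → (Fin k → Vec n) → Subset n → Set
  M θ G I = ModIndepCols θ G I

  IsContractionCircuit : ∀ {n} → (S : Subset n) → (Subset n → Set) →
                         (T : Subset n) → Subset n → Set
  IsContractionCircuit S Ind T D =
    (Σ (Subset _) λ D₀ → IsCircuit S Ind D₀ × D ≡ D₀ ─ T) ×
    (∀ D′ → (Σ (Subset _) λ D₀ → IsCircuit S Ind D₀ × D′ ≡ D₀ ─ T) →
       D′ ⊆ D → D′ ≡ D)

  -- Shortening. A vector on E ∖ Y is represented by its extension by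
  -- zeros to E: C_Y = { c ∈ C : c_i = 0 for i ∈ Y }.

  Shorten : ∀ {n} → (Vec n → Set) → Subset n → Vec n → Set
  Shorten C Y v = C v × (∀ i → i ∈ Y → v i ≈ 0#)

  ShortenAt : ∀ {n} → (Vec n → Set) → Fin n → Vec n → Set
  ShortenAt C e v = C v × v e ≈ 0#

  ContractibleAt : ∀ {n} → Carrier → (Vec n → Set) → Fin n → Set
  ContractibleAt θ C e =
    ¬ (∀ c → C c → c e ≈ 0#) ×
    Σ ℕ λ t →
      (∀ x → (Σ _ λ c → C c × c e ≈ x) ⇔ ⟨ pow θ t ⟩ x) ×
      (Σ _ λ c → C c × (Σ Carrier λ u → IsUnit u × c e ≈ u * pow θ t) ×
                 (∀ i → ⟨ pow θ t ⟩ (c i)))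

  ContractibleAlong : ∀ {n} → Carrier → (Vec n → Set) → List (Fin n) → Set
  ContractibleAlong θ C []       = Unit
  ContractibleAlong θ C (x ∷ xs) =
    ContractibleAt θ C x × ContractibleAlong θ (ShortenAt C x) xs

  ContractibleBy : ∀ {n} → Carrier → (Vec n → Set) → Subset n → Set
  ContractibleBy θ C X =
    Σ (List (Fin _)) λ xs → Unique xs × (∀ i → i ∈ X ⇔ i LMem.∈ xs) ×
      ContractibleAlong θ C xs

-- Dually, I is independent in M(C) iff every α ⊥ C supported on I takes values in 𝔪 = ⟨θ⟩ on I;
-- this depends on C only, not on the generator matrix. Contractibility of C by x yields a pivot
-- codeword c₀ ∈ C whose x-entry is nonzero and divides both the x-column of C and every entry of c₀.
-- With it, a dual vector of the shortened code C_x becomes a dual vector of C after changing its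
-- x-coordinate, and a dual vector of C lying in 𝔪 off x also lies in 𝔪 at x (by Nakayama, as R is
-- local). Iterating along the ordering of X shows that for D disjoint from X, D is independent in
-- M(C_X) iff D ∪ X is independent in M(C); for independence systems this transfer is exactly what
-- identifies the circuits of M(C_X) with those of M(C)/X.
module Submission where

open import Defs
open import Level using (0ℓ)
open import Algebra.Bundles using (CommutativeRing)
open import Data.Nat using (ℕ; zero; suc)
open import Data.Fin using (Fin; zero; suc)
open import Data.Fin.Subset using (Subset; ∁; ⊤; _∈_; _∉_; _⊆_; _⊂_; _─_; _∪_; inside; outside)
open import Data.Fin.Subset.Properties
  using ( _∈?_; ⊆-antisym; ∈⊤; x∈p∪q⁺; x∈p∪q⁻; p─q⊆p; x∈p∧x∉q⇒x∈p─q
        ; x∉p⇒x∈∁p; x∈∁p⇒x∉p; x∉∁p⇒x∈p)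
open import Data.Fin.Subset.Induction using (⊂-wellFounded)
open import Data.Fin.Properties using (_≟_)
open import Data.Vec.Base using (_∷_; here; there)
open import Data.List using (List; []; _∷_)
open import Data.List.Relation.Unary.Any using (here; there)
open import Data.List.Membership.Propositional using () renaming (_∈_ to _∈ₗ_; _∉_ to _∉ₗ_)
open import Data.Product using (Σ; _×_; _,_; proj₁; proj₂)
open import Data.Sum using (_⊎_; inj₁; inj₂; [_,_]; map₂)
open import Function.Bundles using (_⇔_; mk⇔; Equivalence)
open import Function.Construct.Composition using (_⇔-∘_)
open import Function.Construct.Symmetry using (⇔-sym)
open import Induction.WellFounded using (WfRec; module All)
open import Axiom.ExcludedMiddle using (ExcludedMiddle)
open import Relation.Nullary using (¬_; yes; no; contradiction)
open import Relation.Nullary.Decidable using (decidable-stable)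
open import Relation.Binary.PropositionalEquality as ≡ using (_≡_; _≢_)

open Equivalence using (to; from)

x∈p─q⇒x∉q : ∀ {n} (p q : Subset n) {x} → x ∈ p ─ q → x ∉ q
x∈p─q⇒x∉q (inside ∷ p) (outside ∷ q) here          ()
x∈p─q⇒x∉q (_ ∷ p)      (_ ∷ q)      (there x∈p─q) (there x∈q) = x∈p─q⇒x∉q p q x∈p─q x∈q

p─q⊆∁q : ∀ {n} (p q : Subset n) → p ─ q ⊆ ∁ q
p─q⊆∁q p q x∈p─q = x∉p⇒x∈∁p (x∈p─q⇒x∉q p q x∈p─q)

p⊆p─q∪q : ∀ {n} (p q : Subset n) → p ⊆ (p ─ q) ∪ q
p⊆p─q∪q p q {x} x∈p with x ∈? q
... | yes x∈q = x∈p∪q⁺ (inj₂ x∈q)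
... | no  x∉q = x∈p∪q⁺ (inj₁ (x∈p∧x∉q⇒x∈p─q x∈p x∉q))

p⊆q∪r⇒p─r⊆q : ∀ {n} {p q r : Subset n} → p ⊆ q ∪ r → p ─ r ⊆ q
p⊆q∪r⇒p─r⊆q {p = p} {q} {r} p⊆q∪r x∈p─r with x∈p∪q⁻ q r (p⊆q∪r (p─q⊆p p r x∈p─r))
... | inj₁ x∈q = x∈q
... | inj₂ x∈r = contradiction x∈r (x∈p─q⇒x∉q p r x∈p─r)

⊆∧⊄⇒≡ : ∀ {n} {p q : Subset n} → p ⊆ q → ¬ p ⊂ q → p ≡ q
⊆∧⊄⇒≡ {p = p} {q} p⊆q p⊄q = ⊆-antisym p⊆q q⊆p
  where
  q⊆p : q ⊆ p
  q⊆p {x} x∈q with x ∈? p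
  ... | yes x∈p = x∈p
  ... | no  x∉p = contradiction ((λ {y} → p⊆q {y}) , x , x∈q , x∉p) p⊄q

-- The ring is only a (phantom) parameter of IsCircuit and IsContractionCircuit.
module IndependenceSystem (R : CommutativeRing 0ℓ 0ℓ) (em : ExcludedMiddle 0ℓ) {n : ℕ} where

  ∃circuit⊆ : (Ind : Subset n → Set) → ∀ T → ¬ Ind T →
              Σ (Subset n) λ D → D ⊆ T × IsCircuit R ⊤ Ind D
  ∃circuit⊆ Ind = All.wfRec ⊂-wellFounded 0ℓ CircuitBelow step
    where
    CircuitBelow : Subset n → Set
    CircuitBelow T = ¬ Ind T → Σ (Subset n) λ D → D ⊆ T × IsCircuit R ⊤ Ind D
    step : ∀ T → WfRec _⊂_ CircuitBelow T → CircuitBelow T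
    step T rec ¬T with em {Σ (Subset n) λ T′ → T′ ⊂ T × ¬ Ind T′}
    ... | yes (T′ , T′⊂T , ¬T′) =
      let D , D⊆T′ , D-circuit = rec T′⊂T ¬T′
      in  D , (λ x∈D → proj₁ T′⊂T (D⊆T′ x∈D)) , D-circuit
    ... | no ∄T′ = T , (λ x∈T → x∈T) , (λ {_} _ → ∈⊤) , ¬T ,
      λ T′ T′⊂T → decidable-stable em λ ¬T′ → ∄T′ (T′ , T′⊂T , ¬T′)

  module _ {Ind Ind′ : Subset n → Set} {X : Subset n}
           (Ind-mono : ∀ {A B} → A ⊆ B → Ind B → Ind A)
           (Ind′⇔Ind∪X : ∀ {D} → D ⊆ ∁ X → Ind′ D ⇔ Ind (D ∪ X)) where

    IsContractedCircuit : Subset n → Set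
    IsContractedCircuit D = Σ (Subset n) λ D₀ → IsCircuit R ⊤ Ind D₀ × D ≡ D₀ ─ X

    contractedCircuit-dependent : ∀ {D} → D ⊆ ∁ X → IsContractedCircuit D → ¬ Ind′ D
    contractedCircuit-dependent D⊆∁X (D₀ , (_ , ¬D₀ , _) , ≡.refl) D-ind =
      ¬D₀ (Ind-mono (p⊆p─q∪q D₀ X) (to (Ind′⇔Ind∪X D⊆∁X) D-ind))

    ∃circuit⊆∪ : ∀ {D} → D ⊆ ∁ X → ¬ Ind′ D →
                 Σ (Subset n) λ D₀ → D₀ ⊆ D ∪ X × IsCircuit R ⊤ Ind D₀
    ∃circuit⊆∪ {D} D⊆∁X ¬D = ∃circuit⊆ Ind (D ∪ X) λ D∪X-ind → ¬D (from (Ind′⇔Ind∪X D⊆∁X) D∪X-ind)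

    circuit⇒contractionCircuit : ∀ {D} → IsCircuit R (∁ X) Ind′ D →
                                 IsContractionCircuit R ⊤ Ind X D
    circuit⇒contractionCircuit {D} (D⊆∁X , ¬D , D-minimal) with ∃circuit⊆∪ D⊆∁X ¬D
    ... | D₀ , D₀⊆D∪X , D₀-circuit =
      (D₀ , D₀-circuit , ≡.sym (maximal (D₀ ─ X) (D₀ , D₀-circuit , ≡.refl) (p⊆q∪r⇒p─r⊆q D₀⊆D∪X))) ,
      maximal
      where
      maximal : ∀ D′ → IsContractedCircuit D′ → D′ ⊆ D → D′ ≡ D
      maximal D′ D′-contracted D′⊆D = ⊆∧⊄⇒≡ D′⊆D λ D′⊂D →
        contractedCircuit-dependent (λ x∈D′ → D⊆∁X (D′⊆D x∈D′)) D′-contracted (D-minimal D′ D′⊂D)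

    contractionCircuit⇒circuit : ∀ {D} → IsContractionCircuit R ⊤ Ind X D →
                                 IsCircuit R (∁ X) Ind′ D
    contractionCircuit⇒circuit {D} (D-contracted@(D₀ , _ , D≡D₀─X) , maximal) =
      D⊆∁X , contractedCircuit-dependent D⊆∁X D-contracted , proper⇒Ind′
      where
      D⊆∁X : D ⊆ ∁ X
      D⊆∁X x∈D = p─q⊆∁q D₀ X (≡.subst (_ ∈_) D≡D₀─X x∈D)
      proper⇒Ind′ : ∀ D′ → D′ ⊂ D → Ind′ D′
      proper⇒Ind′ D′ (D′⊆D , x , x∈D , x∉D′) = decidable-stable em λ ¬D′ →
        let D₁ , D₁⊆D′∪X , D₁-circuit = ∃circuit⊆∪ (λ y∈D′ → D⊆∁X (D′⊆D y∈D′)) ¬D′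
            D₁─X⊆D′ = p⊆q∪r⇒p─r⊆q D₁⊆D′∪X
            D₁─X≡D  = maximal (D₁ ─ X) (D₁ , D₁-circuit , ≡.refl) λ y → D′⊆D (D₁─X⊆D′ y)
        in  x∉D′ (D₁─X⊆D′ (≡.subst (x ∈_) (≡.sym D₁─X≡D) x∈D))

    circuit⇔contractionCircuit : ∀ D → IsCircuit R (∁ X) Ind′ D ⇔ IsContractionCircuit R ⊤ Ind X D
    circuit⇔contractionCircuit D = mk⇔ circuit⇒contractionCircuit contractionCircuit⇒circuit

-- IsMaximalIdeal quantifies over all predicates, so it applies to the ideal "P or 𝔪", which decides P.
maximal⇒excludedMiddle : (R : CommutativeRing 0ℓ 0ℓ) {𝔪 : CommutativeRing.Carrier R → Set} →
                         IsMaximalIdeal R 𝔪 → ExcludedMiddle 0ℓ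
maximal⇒excludedMiddle R {𝔪} (𝔪-ideal , 1∉𝔪 , 𝔪-maximal) {P}
  with 𝔪-maximal (λ x → P ⊎ 𝔪 x) P∨𝔪-ideal (λ _ → inj₂)
  where
  open IsIdeal 𝔪-ideal
  P∨𝔪-ideal : IsIdeal R (λ x → P ⊎ 𝔪 x)
  P∨𝔪-ideal = record
    { resp     = λ x≈y → map₂ (resp x≈y)
    ; zero∈    = inj₂ zero∈
    ; +-closed = λ { (inj₁ p) _ → inj₁ p
                   ; _ (inj₁ p) → inj₁ p
                   ; (inj₂ x∈𝔪) (inj₂ y∈𝔪) → inj₂ (+-closed x∈𝔪 y∈𝔪) }
    ; *-closed = λ r → map₂ (*-closed r)
    }
... | inj₁ P∨𝔪⊆𝔪    = no λ p → 1∉𝔪 (P∨𝔪⊆𝔪 _ (inj₁ p))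
... | inj₂ (inj₁ p)   = yes p
... | inj₂ (inj₂ 1∈𝔪) = contradiction 1∈𝔪 1∉𝔪

module Codes (R : CommutativeRing 0ℓ 0ℓ) where

  open CommutativeRing R hiding (zero)
  open import Algebra.Properties.Ring ring using (-‿distribˡ-*; [y-z]x≈yx-zx; +-inverseʳ-unique)
  open import Algebra.Properties.CommutativeSemigroup *-commutativeSemigroup
    using (interchange; x∙yz≈y∙xz; xy∙z≈y∙xz)
  open import Algebra.Properties.Semiring.Sum semiring
    using (sum; sum-cong-≋; sum-cong-≗; sum-replicate-zero; ∑-distrib-+; ∑-comm; *-distribˡ-sum)
  open import Data.Vec.Functional using (updateAt; tail)
  open import Data.Vec.Functional.Properties using (updateAt-updates; updateAt-minimal; updateAt-id-local)
  open import Relation.Binary.Reasoning.Setoid setoid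

  private variable n : ℕ

  infix 4 _∈⟨_⟩
  _∈⟨_⟩ : Carrier → Carrier → Set
  x ∈⟨ a ⟩ = ⟨_⟩ R a x

  ∈⟨⟩-resp : ∀ {a x y} → x ≈ y → x ∈⟨ a ⟩ → y ∈⟨ a ⟩
  ∈⟨⟩-resp x≈y (r , x≈ra) = r , trans (sym x≈y) x≈ra

  0∈⟨⟩ : ∀ {a} → 0# ∈⟨ a ⟩
  0∈⟨⟩ {a} = 0# , sym (zeroˡ a)

  ∈⟨⟩-+ : ∀ {a x y} → x ∈⟨ a ⟩ → y ∈⟨ a ⟩ → x + y ∈⟨ a ⟩
  ∈⟨⟩-+ {a} (r , x≈ra) (s , y≈sa) = r + s , trans (+-cong x≈ra y≈sa) (sym (distribʳ a r s))

  ∈⟨⟩-*ˡ : ∀ {a} r {x} → x ∈⟨ a ⟩ → r * x ∈⟨ a ⟩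
  ∈⟨⟩-*ˡ {a} r (s , x≈sa) = r * s , trans (*-congˡ x≈sa) (sym (*-assoc r s a))

  ∈⟨⟩-* : ∀ {a b x y} → x ∈⟨ a ⟩ → y ∈⟨ b ⟩ → x * y ∈⟨ a * b ⟩
  ∈⟨⟩-* {a} {b} (r , x≈ra) (s , y≈sb) = r * s , trans (*-cong x≈ra y≈sb) (interchange r a s b)

  ∈⟨⟩-neg : ∀ {a x} → x ∈⟨ a ⟩ → - x ∈⟨ a ⟩
  ∈⟨⟩-neg {a} (r , x≈ra) = - r , trans (-‿cong x≈ra) (-‿distribˡ-* r a)

  ∈⟨⟩-sum : ∀ {a k} (f : Fin k → Carrier) → (∀ i → f i ∈⟨ a ⟩) → sum f ∈⟨ a ⟩
  ∈⟨⟩-sum {k = zero}  _ _     = 0∈⟨⟩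
  ∈⟨⟩-sum {k = suc k} f f∈⟨a⟩ = ∈⟨⟩-+ (f∈⟨a⟩ zero) (∈⟨⟩-sum (λ i → f (suc i)) (λ i → f∈⟨a⟩ (suc i)))

  ∈⟨⟩-trans : ∀ {a b x} → x ∈⟨ a ⟩ → a ∈⟨ b ⟩ → x ∈⟨ b ⟩
  ∈⟨⟩-trans (r , x≈ra) a∈⟨b⟩ = ∈⟨⟩-resp (sym x≈ra) (∈⟨⟩-*ˡ r a∈⟨b⟩)

  a∈⟨a⟩ : ∀ a → a ∈⟨ a ⟩
  a∈⟨a⟩ a = 1# , sym (*-identityˡ a)

  ⟨⟩-isIdeal : ∀ a → IsIdeal R (⟨_⟩ R a)
  ⟨⟩-isIdeal a = record { resp = ∈⟨⟩-resp ; zero∈ = 0∈⟨⟩ ; +-closed = ∈⟨⟩-+ ; *-closed = ∈⟨⟩-*ˡ }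

  x∈⟨u*x⟩ : ∀ {u x} → IsUnit R u → x ∈⟨ u * x ⟩
  x∈⟨u*x⟩ {u} {x} (v , u*v≈1) = v , (begin
    x             ≈⟨ *-identityˡ x ⟨
    1# * x        ≈⟨ *-congʳ u*v≈1 ⟨
    (u * v) * x   ≈⟨ xy∙z≈y∙xz u v x ⟩
    v * (u * x)   ∎)

  unit*-cancel : ∀ {a u x} → IsUnit R u → u * x ∈⟨ a ⟩ → x ∈⟨ a ⟩
  unit*-cancel u-unit = ∈⟨⟩-trans (x∈⟨u*x⟩ u-unit)

  sumF≡sum : ∀ {k} (f : Fin k → Carrier) → sumF R f ≡ sum f
  sumF≡sum {zero}  f = ≡.refl
  sumF≡sum {suc k} f = ≡.cong (f zero +_) (sumF≡sum (λ i → f (suc i)))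

  sum-zero : ∀ {k} {f : Fin k → Carrier} → (∀ i → f i ≈ 0#) → sum f ≈ 0#
  sum-zero {k} f≈0 = trans (sum-cong-≋ f≈0) (sum-replicate-zero k)

  infix 7 _·_
  _·_ : Vec R n → Vec R n → Carrier
  α · c = sum λ i → α i * c i

  infix 4 _⊥_
  _⊥_ : Vec R n → (Vec R n → Set) → Set
  α ⊥ C = ∀ {c} → C c → α · c ≈ 0#

  infixl 6 _[_]≔_
  _[_]≔_ : Vec R n → Fin n → Carrier → Vec R n
  α [ x ]≔ d = updateAt α x λ _ → d

  []≔-elim : ∀ (P : Fin n → Carrier → Set) {α x d} →
             P x d → (∀ i → i ≢ x → P i (α i)) → ∀ i → P i ((α [ x ]≔ d) i)
  []≔-elim P {α} {x} Pxd Pα i with i ≟ x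
  ... | yes ≡.refl = ≡.subst (P i) (≡.sym (updateAt-updates i α)) Pxd
  ... | no  i≢x    = ≡.subst (P i) (≡.sym (updateAt-minimal i x α i≢x)) (Pα i i≢x)

  ·-linear : ∀ {n} (γ c c′ : Vec R n) k → γ · (λ i → c i + k * c′ i) ≈ γ · c + k * (γ · c′)
  ·-linear {n} γ c c′ k = begin
    sum {n} (λ i → γ i * (c i + k * c′ i))
      ≈⟨ sum-cong-≋ {n} (λ i → trans (distribˡ _ _ _) (+-congˡ (x∙yz≈y∙xz _ _ _))) ⟩
    sum {n} (λ i → γ i * c i + k * (γ i * c′ i))
      ≈⟨ ∑-distrib-+ {n} _ _ ⟩
    γ · c + sum {n} (λ i → k * (γ i * c′ i))
      ≈⟨ +-congˡ (*-distribˡ-sum {n} k _) ⟨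
    γ · c + k * (γ · c′)
      ∎

  ·-[]≔ : ∀ (α c : Vec R n) x d → (α [ x ]≔ d) · c ≈ (α [ x ]≔ 0#) · c + d * c x
  ·-[]≔ α c zero d = begin
    d * c zero + S               ≈⟨ +-comm _ _ ⟩
    S + d * c zero               ≈⟨ +-congʳ (trans (+-congʳ (zeroˡ _)) (+-identityˡ S)) ⟨
    0# * c zero + S + d * c zero ∎
    where S = sum λ i → α (suc i) * c (suc i)
  ·-[]≔ α c (suc x) d = trans (+-congˡ (·-[]≔ (tail α) (tail c) x d)) (sym (+-assoc _ _ _))

  ·-split : ∀ (α c : Vec R n) x → α · c ≈ (α [ x ]≔ 0#) · c + α x * c x
  ·-split α c x = trans (reflexive (sum-cong-≗ α·c≗α[x]≔αx·c)) (·-[]≔ α c x (α x))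
    where
    α·c≗α[x]≔αx·c : ∀ i → α i * c i ≡ (α [ x ]≔ α x) i * c i
    α·c≗α[x]≔αx·c i = ≡.cong (_* c i) (≡.sym (updateAt-id-local x α ≡.refl i))

  ·-[]≔-vanishing : ∀ (α : Vec R n) x d {c} → c x ≈ 0# → (α [ x ]≔ d) · c ≈ α · c
  ·-[]≔-vanishing α x d {c} cx≈0 = begin
    (α [ x ]≔ d) · c              ≈⟨ ·-[]≔ α c x d ⟩
    (α [ x ]≔ 0#) · c + d * c x   ≈⟨ +-congˡ (trans (*-vanishes d) (sym (*-vanishes (α x)))) ⟩
    (α [ x ]≔ 0#) · c + α x * c x ≈⟨ ·-split α c x ⟨
    α · c                         ∎
    where
    *-vanishes : ∀ r → r * c x ≈ 0#
    *-vanishes r = trans (*-congˡ cx≈0) (zeroʳ r)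

  basis : Fin n → Vec R n
  basis j = (λ _ → 0#) [ j ]≔ 1#

  basis-· : ∀ j (y : Vec R n) → basis j · y ≈ y j
  basis-· j y = begin
    basis j · y                            ≈⟨ ·-[]≔ (λ _ → 0#) y j 1# ⟩
    ((λ _ → 0#) [ j ]≔ 0#) · y + 1# * y j  ≈⟨ +-cong (sum-zero 0*y≈0) (*-identityˡ (y j)) ⟩
    0# + y j                               ≈⟨ +-identityˡ (y j) ⟩
    y j                                    ∎
    where
    0*y≈0 : ∀ i → ((λ _ → 0#) [ j ]≔ 0#) i * y i ≈ 0#
    0*y≈0 i = trans (*-congʳ (reflexive (updateAt-id-local j (λ _ → 0#) ≡.refl i))) (zeroˡ (y i))

  ⊥⇒⊥rows : ∀ {k} {C : Vec R n → Set} {G : Fin k → Vec R n} {α : Vec R n} → Generates R C G →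
            α ⊥ C → ∀ j → sumF R (λ i → α i * G j i) ≈ 0#
  ⊥⇒⊥rows {G = G} {α} G-generates α⊥C j =
    trans (reflexive (sumF≡sum (λ i → α i * G j i))) (α⊥C (from (G-generates (G j)) (basis j , Gj≈)))
    where
    Gj≈ : ∀ i → G j i ≈ sumF R (λ l → basis j l * G l i)
    Gj≈ i = trans (sym (basis-· j (λ l → G l i)))
                  (reflexive (≡.sym (sumF≡sum (λ l → basis j l * G l i))))

  ⊥rows⇒⊥ : ∀ {n k} {C : Vec R n → Set} {G : Fin k → Vec R n} {α : Vec R n} → Generates R C G →
            (∀ j → sumF R (λ i → α i * G j i) ≈ 0#) → α ⊥ C
  ⊥rows⇒⊥ {n} {k} {G = G} {α} G-generates α⊥rows {c} c∈C = begin
    α · c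
      ≈⟨ sum-cong-≋ {n} (λ i → *-congˡ (c≈βG i)) ⟩
    sum {n} (λ i → α i * sum {k} λ j → β j * G j i)
      ≈⟨ sum-cong-≋ {n} (λ i → *-distribˡ-sum {k} (α i) _) ⟩
    sum {n} (λ i → sum {k} λ j → α i * (β j * G j i))
      ≈⟨ ∑-comm {n} {k} _ ⟩
    sum {k} (λ j → sum {n} λ i → α i * (β j * G j i))
      ≈⟨ sum-cong-≋ {k} (λ j → sum-cong-≋ {n} λ i → x∙yz≈y∙xz _ _ _) ⟩
    sum {k} (λ j → sum {n} λ i → β j * (α i * G j i))
      ≈⟨ sum-cong-≋ {k} (λ j → *-distribˡ-sum {n} (β j) _) ⟨
    sum {k} (λ j → β j * (α · G j))
      ≈⟨ sum-zero (λ j → trans (*-congˡ (α·Gj≈0 j)) (zeroʳ (β j))) ⟩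
    0#
      ∎
    where
    β : Fin k → Carrier
    β = proj₁ (to (G-generates c) c∈C)
    c≈βG : ∀ i → c i ≈ sum {k} λ j → β j * G j i
    c≈βG i = trans (proj₂ (to (G-generates c) c∈C) i) (reflexive (sumF≡sum (λ j → β j * G j i)))
    α·Gj≈0 : ∀ j → α · G j ≈ 0#
    α·Gj≈0 j = trans (reflexive (≡.sym (sumF≡sum (λ i → α i * G j i)))) (α⊥rows j)

  shortenAt-isCode : ∀ {C : Vec R n → Set} → IsCode R C → ∀ x → IsCode R (ShortenAt R C x)
  shortenAt-isCode C-code x = record
    { resp     = λ u≈v (u∈C , ux≈0) → resp u≈v u∈C , trans (sym (u≈v x)) ux≈0
    ; zero∈    = zero∈ , refl
    ; +-closed = λ (u∈C , ux≈0) (v∈C , vx≈0) →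
                   +-closed u∈C v∈C , trans (+-cong ux≈0 vx≈0) (+-identityˡ 0#)
    ; *-closed = λ r (u∈C , ux≈0) → *-closed r u∈C , trans (*-congˡ ux≈0) (zeroʳ r)
    }
    where open IsCode C-code

  ShortenAlong : (Vec R n → Set) → List (Fin n) → Vec R n → Set
  ShortenAlong C []       = C
  ShortenAlong C (x ∷ xs) = ShortenAlong (ShortenAt R C x) xs

  shortenAlong⇒shorten : ∀ {C : Vec R n → Set} {X xs} → (∀ i → i ∈ X ⇔ i ∈ₗ xs) →
                         ∀ {c} → ShortenAlong C xs c → Shorten R C X c
  shortenAlong⇒shorten {xs = xs} X⇔xs c∈Cₓₛ =
    proj₁ (vanishing xs c∈Cₓₛ) , λ i i∈X → proj₂ (vanishing xs c∈Cₓₛ) (to (X⇔xs i) i∈X)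
    where
    vanishing : ∀ {C} xs {c} → ShortenAlong C xs c → C c × (∀ {i} → i ∈ₗ xs → c i ≈ 0#)
    vanishing []       c∈C = c∈C , λ ()
    vanishing (x ∷ xs) c∈Cₓₛ with vanishing xs c∈Cₓₛ
    ... | (c∈C , cx≈0) , c-vanishes =
      c∈C , λ { (here ≡.refl) → cx≈0 ; (there i∈xs) → c-vanishes i∈xs }

  record Pivot (C : Vec R n → Set) (x : Fin n) : Set where
    field
      pivot          : Vec R n
      pivot∈C        : C pivot
      pivot-x≉0      : ¬ pivot x ≈ 0#
      pivot-divides  : ∀ i → pivot i ∈⟨ pivot x ⟩
      divides-column : ∀ {c} → C c → c x ∈⟨ pivot x ⟩

  ⊥-shortenAt⇒⊥ : ∀ {C : Vec R n → Set} {x} {c₀ γ : Vec R n} → IsCode R C → C c₀ →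
                  (∀ {c} → C c → c x ∈⟨ c₀ x ⟩) → γ ⊥ ShortenAt R C x → γ · c₀ ≈ 0# → γ ⊥ C
  ⊥-shortenAt⇒⊥ {x = x} {c₀} {γ} C-code c₀∈C divides γ⊥Cₓ γ·c₀≈0 {c} c∈C with divides c∈C
  ... | k , cx≈k*c₀x = begin
    γ · c                  ≈⟨ +-identityʳ _ ⟨
    γ · c + 0#             ≈⟨ +-congˡ (zeroʳ (- k)) ⟨
    γ · c + - k * 0#       ≈⟨ +-congˡ (*-congˡ γ·c₀≈0) ⟨
    γ · c + - k * (γ · c₀) ≈⟨ ·-linear γ c c₀ (- k) ⟨
    γ · c′                 ≈⟨ γ⊥Cₓ (+-closed c∈C (*-closed (- k) c₀∈C) , c′x≈0) ⟩
    0#                     ∎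
    where
    open IsCode C-code
    c′ : Vec R _
    c′ i = c i + - k * c₀ i
    c′x≈0 : c′ x ≈ 0#
    c′x≈0 = begin
      c x + - k * c₀ x        ≈⟨ +-cong cx≈k*c₀x (sym (-‿distribˡ-* k (c₀ x))) ⟩
      k * c₀ x + - (k * c₀ x) ≈⟨ -‿inverseʳ _ ⟩
      0#                      ∎

  ⊥-liftAt : ∀ {C : Vec R n → Set} {x} {α : Vec R n} → IsCode R C → Pivot C x →
             α ⊥ ShortenAt R C x → Σ Carrier λ d → α [ x ]≔ d ⊥ C
  ⊥-liftAt {C = C} {x} {α} C-code P α⊥Cₓ =
    - s , ⊥-shortenAt⇒⊥ C-code pivot∈C divides-column γ⊥Cₓ γ·pivot≈0
    where
    open Pivot P
    β·pivot∈⟨pivot-x⟩ : (α [ x ]≔ 0#) · pivot ∈⟨ pivot x ⟩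
    β·pivot∈⟨pivot-x⟩ = ∈⟨⟩-sum _ λ i → ∈⟨⟩-*ˡ ((α [ x ]≔ 0#) i) (pivot-divides i)
    s : Carrier
    s = proj₁ β·pivot∈⟨pivot-x⟩
    γ : Vec R _
    γ = α [ x ]≔ - s
    γ⊥Cₓ : γ ⊥ ShortenAt R C x
    γ⊥Cₓ (c∈C , cx≈0) = trans (·-[]≔-vanishing α x (- s) cx≈0) (α⊥Cₓ (c∈C , cx≈0))
    γ·pivot≈0 : γ · pivot ≈ 0#
    γ·pivot≈0 = begin
      γ · pivot                             ≈⟨ ·-[]≔ α pivot x (- s) ⟩
      (α [ x ]≔ 0#) · pivot + - s * pivot x ≈⟨ +-cong (proj₂ β·pivot∈⟨pivot-x⟩) (sym (-‿distribˡ-* s _)) ⟩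
      s * pivot x + - (s * pivot x)         ≈⟨ -‿inverseʳ _ ⟩
      0#                                    ∎

  module _ (θ : Carrier) where

    contractibleAt⇒pivot : ∀ {C : Vec R n → Set} {x} → ContractibleAt R θ C x → Pivot C x
    contractibleAt⇒pivot {C = C} {x}
      (column≢0 , t , column⇔⟨θᵗ⟩ , c₀ , c₀∈C , (u , u-unit , c₀x≈uθᵗ) , c₀∈⟨θᵗ⟩) = record
      { pivot          = c₀
      ; pivot∈C        = c₀∈C
      ; pivot-x≉0      = λ c₀x≈0 → column≢0 λ c c∈C →
          let r , cx≈r*c₀x = column∈⟨c₀x⟩ c∈C in trans cx≈r*c₀x (trans (*-congˡ c₀x≈0) (zeroʳ r))
      ; pivot-divides  = λ i → ∈⟨⟩-trans (c₀∈⟨θᵗ⟩ i) θᵗ∈⟨c₀x⟩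
      ; divides-column = column∈⟨c₀x⟩
      }
      where
      θᵗ∈⟨c₀x⟩ : pow R θ t ∈⟨ c₀ x ⟩
      θᵗ∈⟨c₀x⟩ = ∈⟨⟩-trans (x∈⟨u*x⟩ u-unit) (1# , trans (sym c₀x≈uθᵗ) (sym (*-identityˡ (c₀ x))))
      column∈⟨c₀x⟩ : ∀ {c} → C c → c x ∈⟨ c₀ x ⟩
      column∈⟨c₀x⟩ {c} c∈C = ∈⟨⟩-trans (to (column⇔⟨θᵗ⟩ (c x)) (c , c∈C , refl)) θᵗ∈⟨c₀x⟩

    ⊥-liftAlong : ∀ {C : Vec R n → Set} {α : Vec R n} xs → IsCode R C → ContractibleAlong R θ C xs →
                  α ⊥ ShortenAlong C xs → Σ (Vec R n) λ α′ → α′ ⊥ C × (∀ i → i ∉ₗ xs → α′ i ≈ α i)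
    ⊥-liftAlong {α = α} [] _ _ α⊥C = α , α⊥C , λ _ _ → refl
    ⊥-liftAlong (x ∷ xs) C-code (contractible , contractibles) α⊥Cₓₛ =
      let α″ , α″⊥Cₓ , α″≈α = ⊥-liftAlong xs (shortenAt-isCode C-code x) contractibles α⊥Cₓₛ
          d , α″[x]⊥C = ⊥-liftAt C-code (contractibleAt⇒pivot contractible) α″⊥Cₓ
      in  α″ [ x ]≔ d , α″[x]⊥C ,
          λ i i∉x∷xs → trans (reflexive (updateAt-minimal i x α″ λ i≡x → i∉x∷xs (here i≡x)))
                             (α″≈α i λ i∈xs → i∉x∷xs (there i∈xs))

    Independent : (Vec R n → Set) → Subset n → Set
    Independent C I = ∀ α → (∀ i → i ∉ I → α i ≈ 0#) → α ⊥ C → ∀ i → i ∈ I → α i ∈⟨ θ ⟩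

    M⇔Independent : ∀ {k} {C : Vec R n → Set} {G : Fin k → Vec R n} {I} → Generates R C G →
                    M R θ G I ⇔ Independent C I
    M⇔Independent {C = C} {G} {I} G-generates = mk⇔ M⇒Independent Independent⇒M
      where
      M⇒Independent : M R θ G I → Independent C I
      M⇒Independent ind α α-supp α⊥C = ind α α-supp (⊥⇒⊥rows G-generates α⊥C)
      Independent⇒M : Independent C I → M R θ G I
      Independent⇒M ind α α-supp α⊥rows = ind α α-supp (⊥rows⇒⊥ G-generates α⊥rows)

    M-mono : ∀ {k} {G : Fin k → Vec R n} {A B} → A ⊆ B → M R θ G B → M R θ G A
    M-mono A⊆B B-ind α α-supp α⊥rows i i∈A =
      B-ind α (λ i i∉B → α-supp i λ i∈A → i∉B (A⊆B i∈A)) α⊥rows i (A⊆B i∈A)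

    module Local (𝔪-maximal : IsMaximalIdeal R (⟨_⟩ R θ))
                 (chain : ∀ (I J : Carrier → Set) → IsIdeal R I → IsIdeal R J →
                          (∀ x → I x → J x) ⊎ (∀ x → J x → I x)) where

      em : ExcludedMiddle 0ℓ
      em = maximal⇒excludedMiddle R 𝔪-maximal

      1∉𝔪 : ¬ 1# ∈⟨ θ ⟩
      1∉𝔪 = proj₁ (proj₂ 𝔪-maximal)

      ∉𝔪⇒unit : ∀ {x} → ¬ x ∈⟨ θ ⟩ → IsUnit R x
      ∉𝔪⇒unit {x} x∉𝔪 with chain (⟨_⟩ R x) (⟨_⟩ R θ) (⟨⟩-isIdeal x) (⟨⟩-isIdeal θ)
      ... | inj₁ ⟨x⟩⊆𝔪 = contradiction (⟨x⟩⊆𝔪 x (a∈⟨a⟩ x)) x∉𝔪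
      ... | inj₂ 𝔪⊆⟨x⟩ with proj₂ (proj₂ 𝔪-maximal) (⟨_⟩ R x) (⟨⟩-isIdeal x) 𝔪⊆⟨x⟩
      ...   | inj₁ ⟨x⟩⊆𝔪       = contradiction (⟨x⟩⊆𝔪 x (a∈⟨a⟩ x)) x∉𝔪
      ...   | inj₂ (r , 1≈r*x) = r , trans (*-comm x r) (sym 1≈r*x)

      ∈⟨θx⟩⇒≈0 : ∀ {x} → x ∈⟨ θ * x ⟩ → x ≈ 0#
      ∈⟨θx⟩⇒≈0 {x} (w , x≈w[θx]) = trans x≈v[ex] (trans (*-congˡ ex≈0) (zeroʳ v))
        where
        e : Carrier
        e = 1# - w * θ
        e∉𝔪 : ¬ e ∈⟨ θ ⟩
        e∉𝔪 e∈𝔪 = 1∉𝔪 (∈⟨⟩-resp e+wθ≈1 (∈⟨⟩-+ e∈𝔪 (∈⟨⟩-*ˡ w (a∈⟨a⟩ θ))))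
          where
          e+wθ≈1 : e + w * θ ≈ 1#
          e+wθ≈1 = trans (+-assoc _ _ _) (trans (+-congˡ (-‿inverseˡ _)) (+-identityʳ 1#))
        x∈⟨ex⟩ : x ∈⟨ e * x ⟩
        x∈⟨ex⟩ = x∈⟨u*x⟩ (∉𝔪⇒unit e∉𝔪)
        v : Carrier
        v = proj₁ x∈⟨ex⟩
        x≈v[ex] : x ≈ v * (e * x)
        x≈v[ex] = proj₂ x∈⟨ex⟩
        ex≈0 : e * x ≈ 0#
        ex≈0 = begin
          (1# - w * θ) * x   ≈⟨ [y-z]x≈yx-zx x 1# (w * θ) ⟩
          1# * x - w * θ * x ≈⟨ +-cong (*-identityˡ x) (-‿cong (trans (*-assoc w θ x) (sym x≈w[θx]))) ⟩
          x - x              ≈⟨ -‿inverseʳ x ⟩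
          0#                 ∎

      -- If α x were a unit, α · pivot ≈ 0# would put pivot x into ⟨θ * pivot x⟩.
      ∈𝔪-atPivot : ∀ {C : Vec R n → Set} {x} {α : Vec R n} → Pivot C x → α ⊥ C →
                   (∀ i → i ≢ x → α i ∈⟨ θ ⟩) → α x ∈⟨ θ ⟩
      ∈𝔪-atPivot {x = x} {α} P α⊥C α∈𝔪 = decidable-stable em λ αx∉𝔪 →
        pivot-x≉0 (∈⟨θx⟩⇒≈0 (unit*-cancel (∉𝔪⇒unit αx∉𝔪) αx*p∈⟨θp⟩))
        where
        open Pivot P
        β∈𝔪 : ∀ i → (α [ x ]≔ 0#) i ∈⟨ θ ⟩
        β∈𝔪 = []≔-elim (λ _ r → r ∈⟨ θ ⟩) 0∈⟨⟩ α∈𝔪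
        β·pivot∈⟨θp⟩ : (α [ x ]≔ 0#) · pivot ∈⟨ θ * pivot x ⟩
        β·pivot∈⟨θp⟩ = ∈⟨⟩-sum _ λ i → ∈⟨⟩-* (β∈𝔪 i) (pivot-divides i)
        αx*p∈⟨θp⟩ : α x * pivot x ∈⟨ θ * pivot x ⟩
        αx*p∈⟨θp⟩ = ∈⟨⟩-resp
          (sym (+-inverseʳ-unique _ _ (trans (sym (·-split α pivot x)) (α⊥C pivot∈C))))
          (∈⟨⟩-neg β·pivot∈⟨θp⟩)

      ∈𝔪-along : ∀ {C : Vec R n → Set} {α : Vec R n} xs → IsCode R C → ContractibleAlong R θ C xs →
                 α ⊥ C → (∀ i → i ∉ₗ xs → α i ∈⟨ θ ⟩) → ∀ i → α i ∈⟨ θ ⟩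
      ∈𝔪-along [] _ _ _ α∈𝔪 i = α∈𝔪 i λ ()
      ∈𝔪-along {C = C} {α} (x ∷ xs) C-code (contractible , contractibles) α⊥C α∈𝔪 = α∈𝔪-everywhere
        where
        β : Vec R _
        β = α [ x ]≔ 0#
        β⊥Cₓ : β ⊥ ShortenAt R C x
        β⊥Cₓ (c∈C , cx≈0) = trans (·-[]≔-vanishing α x 0# cx≈0) (α⊥C c∈C)
        β∈𝔪 : ∀ i → β i ∈⟨ θ ⟩
        β∈𝔪 = ∈𝔪-along xs (shortenAt-isCode C-code x) contractibles β⊥Cₓ
          ([]≔-elim (λ i r → i ∉ₗ xs → r ∈⟨ θ ⟩) (λ _ → 0∈⟨⟩)
             λ i i≢x i∉xs → α∈𝔪 i λ { (here i≡x) → i≢x i≡x ; (there i∈xs) → i∉xs i∈xs })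
        α∈𝔪-off-x : ∀ i → i ≢ x → α i ∈⟨ θ ⟩
        α∈𝔪-off-x i i≢x = ∈⟨⟩-resp (reflexive (updateAt-minimal i x α i≢x)) (β∈𝔪 i)
        α∈𝔪-everywhere : ∀ i → α i ∈⟨ θ ⟩
        α∈𝔪-everywhere i with i ≟ x
        ... | yes ≡.refl = ∈𝔪-atPivot (contractibleAt⇒pivot contractible) α⊥C α∈𝔪-off-x
        ... | no  i≢x    = α∈𝔪-off-x i i≢x

      restrict : Subset n → Vec R n → Vec R n
      restrict S α i with i ∈? S
      ... | yes _ = α i
      ... | no  _ = 0#

      restrict-elim : ∀ (P : Carrier → Set) {S : Subset n} {α i} →
                      (i ∈ S → P (α i)) → (i ∉ S → P 0#) → P (restrict S α i)
      restrict-elim P {S} {i = i} P-in P-out with i ∈? S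
      ... | yes i∈S = P-in i∈S
      ... | no  i∉S = P-out i∉S

      module _ {C : Vec R n → Set} {X : Subset n} {xs : List (Fin n)} (C-code : IsCode R C)
               (X⇔xs : ∀ i → i ∈ X ⇔ i ∈ₗ xs) (contractible : ContractibleAlong R θ C xs)
               {D : Subset n} (D⊆∁X : D ⊆ ∁ X) where

        independent∪⇒shortenIndependent : Independent C (D ∪ X) → Independent (Shorten R C X) D
        independent∪⇒shortenIndependent D∪X-ind α α-supp α⊥Cₓ i i∈D
          with ⊥-liftAlong xs C-code contractible (λ c∈Cₓₛ → α⊥Cₓ (shortenAlong⇒shorten X⇔xs c∈Cₓₛ))
        ... | α′ , α′⊥C , α′≈α =
          ∈⟨⟩-resp (α′≈α i (∉X⇒∉xs (x∈∁p⇒x∉p (D⊆∁X i∈D))))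
                   (D∪X-ind α′ α′-supp α′⊥C i (x∈p∪q⁺ (inj₁ i∈D)))
          where
          ∉X⇒∉xs : ∀ {i} → i ∉ X → i ∉ₗ xs
          ∉X⇒∉xs {i} i∉X i∈xs = i∉X (from (X⇔xs i) i∈xs)
          α′-supp : ∀ i → i ∉ D ∪ X → α′ i ≈ 0#
          α′-supp i i∉D∪X = trans (α′≈α i (∉X⇒∉xs λ i∈X → i∉D∪X (x∈p∪q⁺ (inj₂ i∈X))))
                                  (α-supp i λ i∈D → i∉D∪X (x∈p∪q⁺ (inj₁ i∈D)))

        shortenIndependent⇒independent∪ : Independent (Shorten R C X) D → Independent C (D ∪ X)
        shortenIndependent⇒independent∪ D-ind α α-supp α⊥C i _ =
          ∈𝔪-along xs C-code contractible α⊥C α∈𝔪-off-xs i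
          where
          β : Vec R _
          β = restrict (∁ X) α
          β-supp : ∀ i → i ∉ D → β i ≈ 0#
          β-supp i i∉D = restrict-elim (_≈ 0#)
            (λ i∈∁X → α-supp i λ i∈D∪X → [ i∉D , x∈∁p⇒x∉p i∈∁X ] (x∈p∪q⁻ D X i∈D∪X)) (λ _ → refl)
          β⊥Cₓ : β ⊥ Shorten R C X
          β⊥Cₓ {c} (c∈C , c-vanishes) = trans (sum-cong-≋ βc≈αc) (α⊥C c∈C)
            where
            βc≈αc : ∀ i → β i * c i ≈ α i * c i
            βc≈αc i = restrict-elim (λ r → r * c i ≈ α i * c i) (λ _ → refl) λ i∉∁X →
              let ci≈0 = c-vanishes i (x∉∁p⇒x∈p i∉∁X)
              in  trans (*-congˡ ci≈0) (trans (zeroʳ 0#) (sym (trans (*-congˡ ci≈0) (zeroʳ (α i)))))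
          α∈𝔪-off-xs : ∀ i → i ∉ₗ xs → α i ∈⟨ θ ⟩
          α∈𝔪-off-xs i i∉xs with i ∈? D
          ... | yes i∈D = restrict-elim (λ r → r ∈⟨ θ ⟩ → α i ∈⟨ θ ⟩) (λ _ αi∈𝔪 → αi∈𝔪)
                            (λ i∉∁X → contradiction (D⊆∁X i∈D) i∉∁X) (D-ind β β-supp β⊥Cₓ i i∈D)
          ... | no  i∉D = ∈⟨⟩-resp (sym (α-supp i λ i∈D∪X →
                            [ i∉D , (λ i∈X → i∉xs (to (X⇔xs i) i∈X)) ] (x∈p∪q⁻ D X i∈D∪X))) 0∈⟨⟩

        shortenIndependent⇔independent∪ : Independent (Shorten R C X) D ⇔ Independent C (D ∪ X)
        shortenIndependent⇔independent∪ =
          mk⇔ shortenIndependent⇒independent∪ independent∪⇒shortenIndependent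

corollary4p14 :
    (R : CommutativeRing 0ℓ 0ℓ) → IsFiniteChainRing R →
    (θ : CommutativeRing.Carrier R) → IsMaximalIdeal R (⟨_⟩ R θ) →
    (n : ℕ) (C : Vec R n → Set) → IsCode R C →
    (X : Subset n) → ContractibleBy R θ C X →
    (k : ℕ) (G : Fin k → Vec R n) → MinimallyGenerates R C G →
    (k′ : ℕ) (G′ : Fin k′ → Vec R n) → MinimallyGenerates R (Shorten R C X) G′ →
    M R θ G X →
    ∀ (D : Subset n) →
      IsCircuit R (∁ X) (M R θ G′) D ⇔ IsContractionCircuit R ⊤ (M R θ G) X D
corollary4p14 R finiteChain θ 𝔪-maximal n C C-code X (xs , _ , X⇔xs , contractible)
              k G (G-generates , _) k′ G′ (G′-generates , _) _ =
  circuit⇔contractionCircuit (M-mono θ) M′⇔M∪X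
  where
  open Codes R
  open Codes.Local R θ 𝔪-maximal (IsFiniteChainRing.chain finiteChain)
  open IndependenceSystem R em {n}
  M′⇔M∪X : ∀ {D} → D ⊆ ∁ X → M R θ G′ D ⇔ M R θ G (D ∪ X)
  M′⇔M∪X D⊆∁X = ⇔-sym (M⇔Independent θ G-generates)
             ⇔-∘ (shortenIndependent⇔independent∪ C-code X⇔xs contractible D⊆∁X
             ⇔-∘ M⇔Independent θ G′-generates)
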